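{- Let $\psi_1,\dots,\psi_m$ be partial-assignment algorithms, each composition-friendly, with $\psi_i$ being $s_i$-switching-cost bounded. Then the partial-assignment algorithm that applies $\psi_1,\psi_2,\dots,\psi_m$ in sequence is composition-friendly and is $\left(\sum_{i=1}^m s_i\right)$-switching-cost bounded.
   Context: Fix positive integers $w,n$. A worker/task input is a pair $(W,T)$ with $W\subseteq[w]$, $T\subseteq[n]$, $|W|=|T|$. A partial-assignment algorithm maps each worker/task input to a matching between a subset of $W$ and a subset of $T$ (its set of assignments); the unmatched elements form the worker/task output $(W',T')$, with $|W'|=|T'|$. Applying algorithms in sequence means each acts on the output of the previous one; the assignments of the sequence are the union of the assignments of each step. Inputs $(W_1,T_1),(W_2,T_2)$ are unit distance if $|W_1\setminus W_2|+|W_2\setminus W_1|+|T_1\setminus T_2|+|T_2\setminus T_1|\le 2$. An algorithm is composition-friendly if unit-distance inputs always yield unit-distance outputs, and $s$-switching-cost bounded if for every unit-distance pair of inputs the sets of assignments made on the two inputs have symmetric difference of size at most $s$. -}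

module Defs where

open import Data.Nat using (ℕ; zero; suc; _+_; _≤_)
open import Data.Bool using (Bool; true; false; _∨_; _xor_; if_then_else_)
open import Data.Fin using (Fin; zero; suc)
open import Data.Fin.Subset using (Subset; _─_; ∣_∣; _∈_)
open import Data.Vec using (tabulate)
open import Data.Product using (_×_; _,_; proj₁; proj₂)
open import Relation.Binary.PropositionalEquality using (_≡_)

-- Workers are Fin w (= [w]), tasks are Fin n (= [n]).

-- A set of assignments: a set of worker/task pairs, as its indicator.
Assign : ℕ → ℕ → Set
Assign w n = Fin w → Fin n → Bool

anyFin : {k : ℕ} → (Fin k → Bool) → Bool
anyFin {zero}  f = false
anyFin {suc k} f = f zero ∨ anyFin (λ i → f (suc i))

sumFin : {k : ℕ} → (Fin k → ℕ) → ℕ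
sumFin {zero}  f = 0
sumFin {suc k} f = f zero + sumFin (λ i → f (suc i))

count : {w n : ℕ} → Assign w n → ℕ
count {w} {n} A = sumFin (λ i → sumFin (λ j → if A i j then 1 else 0))

symDiffSize : {w n : ℕ} → Assign w n → Assign w n → ℕ
symDiffSize A B = count (λ i j → A i j xor B i j)

_∪A_ : {w n : ℕ} → Assign w n → Assign w n → Assign w n
(A ∪A B) i j = A i j ∨ B i j

noAssign : {w n : ℕ} → Assign w n
noAssign i j = false

Balanced : {w n : ℕ} → Subset w → Subset n → Set
Balanced W T = ∣ W ∣ ≡ ∣ T ∣

record IsMatching {w n : ℕ} (W : Subset w) (T : Subset n) (A : Assign w n) : Set where
  field
    inW     : ∀ i j → A i j ≡ true → i ∈ W
    inT     : ∀ i j → A i j ≡ true → j ∈ T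
    uniqueT : ∀ i j j′ → A i j ≡ true → A i j′ ≡ true → j ≡ j′
    uniqueW : ∀ i i′ j → A i j ≡ true → A i′ j ≡ true → i ≡ i′

-- A (candidate) algorithm: maps a pair (W,T) to a set of assignments.
-- Only its values on worker/task inputs (|W| = |T|) matter.
Alg : ℕ → ℕ → Set
Alg w n = Subset w → Subset n → Assign w n

IsPAA : {w n : ℕ} → Alg w n → Set
IsPAA {w} {n} ψ = ∀ (W : Subset w) (T : Subset n) → Balanced W T → IsMatching W T (ψ W T)

matchedW : {w n : ℕ} → Assign w n → Subset w
matchedW A = tabulate (λ i → anyFin (λ j → A i j))

matchedT : {w n : ℕ} → Assign w n → Subset n
matchedT A = tabulate (λ j → anyFin (λ i → A i j))

output : {w n : ℕ} → Alg w n → Subset w → Subset n → Subset w × Subset n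
output ψ W T = (W ─ matchedW (ψ W T)) , (T ─ matchedT (ψ W T))

_then_ : {w n : ℕ} → Alg w n → Alg w n → Alg w n
(ψ then φ) W T = ψ W T ∪A φ (proj₁ (output ψ W T)) (proj₂ (output ψ W T))

inSequence : {w n m : ℕ} → (Fin m → Alg w n) → Alg w n
inSequence {m = zero}  ψ W T = noAssign
inSequence {m = suc m} ψ = ψ zero then inSequence (λ i → ψ (suc i))

UnitDistance : {w n : ℕ} → Subset w → Subset n → Subset w → Subset n → Set
UnitDistance W₁ T₁ W₂ T₂ =
  ∣ W₁ ─ W₂ ∣ + ∣ W₂ ─ W₁ ∣ + ∣ T₁ ─ T₂ ∣ + ∣ T₂ ─ T₁ ∣ ≤ 2

CompositionFriendly : {w n : ℕ} → Alg w n → Set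
CompositionFriendly {w} {n} ψ =
  ∀ (W₁ : Subset w) (T₁ : Subset n) (W₂ : Subset w) (T₂ : Subset n) →
  Balanced W₁ T₁ → Balanced W₂ T₂ → UnitDistance W₁ T₁ W₂ T₂ →
  UnitDistance (proj₁ (output ψ W₁ T₁)) (proj₂ (output ψ W₁ T₁))
               (proj₁ (output ψ W₂ T₂)) (proj₂ (output ψ W₂ T₂))

SwitchingCostBounded : {w n : ℕ} → ℕ → Alg w n → Set
SwitchingCostBounded {w} {n} s ψ =
  ∀ (W₁ : Subset w) (T₁ : Subset n) (W₂ : Subset w) (T₂ : Subset n) →
  Balanced W₁ T₁ → Balanced W₂ T₂ → UnitDistance W₁ T₁ W₂ T₂ →
  symDiffSize (ψ W₁ T₁) (ψ W₂ T₂) ≤ s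

module Submission where

-- Everything reduces to two algorithms ψ and φ run one after the other
-- (ψ then φ); lemma13 is an induction on the number of algorithms, the
-- empty sequence (which assigns nothing) being the base case.
--   * A matching A of a worker/task input (W,T) matches as many workers
--     as tasks (both equal the number of pairs of A), so the output of ψ
--     is again a worker/task input and the hypotheses on φ apply to it.
--   * ψ assigns only workers and tasks of (W,T) and φ only those that ψ
--     left unmatched, so the union of their assignments is a matching.
--   * The output of (ψ then φ) is φ's output on ψ's output, so unit
--     distance is carried through both steps.
--   * The symmetric difference of two unions is at most the sum of the
--     symmetric differences of the parts, so switching costs add up.

open import Defs
open import Data.Nat using (ℕ; zero; suc; _+_; _≤_; z≤n)
open import Data.Nat.Properties
  using ( module ≤-Reasoning; ≤-refl; ≤-reflexive; ≤-trans; +-mono-≤; +-suc; +-cancelʳ-≡; m≤m+n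
        ; +-0-commutativeMonoid)
open import Data.Bool using (Bool; true; false; _∨_; _xor_; if_then_else_)
open import Data.Bool.Properties using (¬-not; ∨-commutativeMonoid)
open import Data.Fin using (Fin; zero; suc)
open import Data.Fin.Properties using (0≢1+n; suc-injective)
open import Data.Fin.Subset using (Subset; _─_; _∪_; ∣_∣; _∈_; _∉_; _⊆_; ⊥; inside; outside)
open import Data.Fin.Subset.Properties using (drop-∷-⊆; p─q⊆p; p─⊥≡p; p─q─r≡p─q∪r)
open import Data.Vec using (_∷_; []; tabulate; here; there)
open import Data.Vec.Properties using (lookup∘tabulate; []=⇒lookup; lookup⇒[]=; tabulate-cong)
open import Data.Product using (_×_; _,_; proj₁; proj₂; Σ-syntax)
open import Data.Sum using (_⊎_; inj₁; inj₂)
open import Relation.Nullary using (contradiction)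
open import Relation.Binary.PropositionalEquality
open import Algebra.Bundles using (CommutativeMonoid)
open import Algebra.Properties.CommutativeMonoid.Sum +-0-commutativeMonoid
  using (sum; sum-cong-≗; ∑-distrib-+; ∑-comm)
open import Algebra.Properties.CommutativeSemigroup
  (CommutativeMonoid.commutativeSemigroup ∨-commutativeMonoid) using (interchange)

ind : Bool → ℕ
ind b = if b then 1 else 0

ind≤1 : ∀ b → ind b ≤ 1
ind≤1 true  = ≤-refl
ind≤1 false = z≤n

-- `sumFin` is the library's finite sum over (ℕ, +, 0); this bridge lets us
-- reuse the library's distributivity and exchange laws.
sumFin≡sum : ∀ {k} (f : Fin k → ℕ) → sumFin f ≡ sum f
sumFin≡sum {zero}  f = refl
sumFin≡sum {suc k} f = cong (f zero +_) (sumFin≡sum (λ i → f (suc i)))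

sumFin-cong : ∀ {k} {f g : Fin k → ℕ} → (∀ i → f i ≡ g i) → sumFin f ≡ sumFin g
sumFin-cong {zero}  f≗g = refl
sumFin-cong {suc k} f≗g = cong₂ _+_ (f≗g zero) (sumFin-cong (λ i → f≗g (suc i)))

sumFin-mono : ∀ {k} {f g : Fin k → ℕ} → (∀ i → f i ≤ g i) → sumFin f ≤ sumFin g
sumFin-mono {zero}  f≤g = z≤n
sumFin-mono {suc k} f≤g = +-mono-≤ (f≤g zero) (sumFin-mono (λ i → f≤g (suc i)))

sumFin-zero : ∀ {k} → sumFin {k} (λ _ → 0) ≡ 0
sumFin-zero {zero}  = refl
sumFin-zero {suc k} = sumFin-zero {k}

sumFin-distrib : ∀ {k} (f g : Fin k → ℕ) → sumFin (λ i → f i + g i) ≡ sumFin f + sumFin g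
sumFin-distrib f g = begin
  sumFin (λ i → f i + g i)  ≡⟨ sumFin≡sum (λ i → f i + g i) ⟩
  sum (λ i → f i + g i)     ≡⟨ ∑-distrib-+ f g ⟩
  sum f + sum g             ≡⟨ sym (cong₂ _+_ (sumFin≡sum f) (sumFin≡sum g)) ⟩
  sumFin f + sumFin g       ∎
  where open ≡-Reasoning

sumFin-comm : ∀ {a b} (f : Fin a → Fin b → ℕ) →
  sumFin (λ i → sumFin (f i)) ≡ sumFin (λ j → sumFin (λ i → f i j))
sumFin-comm f = begin
  sumFin (λ i → sumFin (f i))           ≡⟨ double f ⟩
  sum (λ i → sum (f i))                 ≡⟨ ∑-comm f ⟩
  sum (λ j → sum (λ i → f i j))         ≡⟨ sym (double (λ j i → f i j)) ⟩
  sumFin (λ j → sumFin (λ i → f i j))   ∎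
  where
  open ≡-Reasoning
  double : ∀ {a b} (g : Fin a → Fin b → ℕ) → sumFin (λ i → sumFin (g i)) ≡ sum (λ i → sum (g i))
  double g = trans (sumFin≡sum (λ i → sumFin (g i))) (sum-cong-≗ (λ i → sumFin≡sum (g i)))

count-noAssign : ∀ {w n} → count {w} {n} noAssign ≡ 0
count-noAssign {w} {n} = trans (cong (λ z → sumFin {w} (λ _ → z)) (sumFin-zero {n})) (sumFin-zero {w})

count-subadditive : ∀ {w n} (A B C : Assign w n) →
  (∀ i j → ind (A i j) ≤ ind (B i j) + ind (C i j)) → count A ≤ count B + count C
count-subadditive {w} A B C bound = begin
  count A                      ≤⟨ sumFin-mono row ⟩
  sumFin (λ i → rowB i + rowC i) ≡⟨ sumFin-distrib rowB rowC ⟩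
  count B + count C            ∎
  where
  open ≤-Reasoning
  rowB rowC : Fin w → ℕ
  rowB i = sumFin (λ j → ind (B i j))
  rowC i = sumFin (λ j → ind (C i j))
  row : ∀ i → sumFin (λ j → ind (A i j)) ≤ rowB i + rowC i
  row i = ≤-trans (sumFin-mono (bound i)) (≤-reflexive (sumFin-distrib (λ j → ind (B i j)) (λ j → ind (C i j))))

transpose : ∀ {w n} → Assign w n → Assign n w
transpose A j i = A i j

count-transpose : ∀ {w n} (A : Assign w n) → count (transpose A) ≡ count A
count-transpose A = sym (sumFin-comm (λ i j → ind (A i j)))

xor-∨-bound : ∀ a₁ b₁ a₂ b₂ → ind ((a₁ ∨ b₁) xor (a₂ ∨ b₂)) ≤ ind (a₁ xor a₂) + ind (b₁ xor b₂)
xor-∨-bound true  b₁ true  b₂ = z≤n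
xor-∨-bound false b₁ false b₂ = ≤-refl
xor-∨-bound true  b₁ false b₂ = ≤-trans (ind≤1 _) (m≤m+n 1 _)
xor-∨-bound false b₁ true  b₂ = ≤-trans (ind≤1 _) (m≤m+n 1 _)

union-symDiff : ∀ {w n} (A₁ B₁ A₂ B₂ : Assign w n) →
  symDiffSize (A₁ ∪A B₁) (A₂ ∪A B₂) ≤ symDiffSize A₁ A₂ + symDiffSize B₁ B₂
union-symDiff A₁ B₁ A₂ B₂ =
  count-subadditive _ _ _ (λ i j → xor-∨-bound (A₁ i j) (B₁ i j) (A₂ i j) (B₂ i j))

∈-tabulate⁺ : ∀ {k} {f : Fin k → Bool} {i} → f i ≡ true → i ∈ tabulate f
∈-tabulate⁺ {f = f} {i} fi = lookup⇒[]= i (tabulate f) (trans (lookup∘tabulate f i) fi)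

∈-tabulate⁻ : ∀ {k} {f : Fin k → Bool} {i} → i ∈ tabulate f → f i ≡ true
∈-tabulate⁻ {f = f} {i} i∈ = trans (sym (lookup∘tabulate f i)) ([]=⇒lookup i∈)

∣tabulate∣ : ∀ {k} (f : Fin k → Bool) → ∣ tabulate f ∣ ≡ sumFin (λ i → ind (f i))
∣tabulate∣ {zero}  f = refl
∣tabulate∣ {suc k} f with f zero
... | true  = cong suc (∣tabulate∣ (λ i → f (suc i)))
... | false = ∣tabulate∣ (λ i → f (suc i))

tabulate-∪ : ∀ {k} (f g : Fin k → Bool) → tabulate f ∪ tabulate g ≡ tabulate (λ i → f i ∨ g i)
tabulate-∪ {zero}  f g = refl
tabulate-∪ {suc k} f g = cong ((f zero ∨ g zero) ∷_) (tabulate-∪ (λ i → f (suc i)) (λ i → g (suc i)))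

∣p─q∣+∣q∣ : ∀ {k} (p q : Subset k) → q ⊆ p → ∣ p ─ q ∣ + ∣ q ∣ ≡ ∣ p ∣
∣p─q∣+∣q∣ []            []            q⊆p = refl
∣p─q∣+∣q∣ (inside  ∷ p) (outside ∷ q) q⊆p = cong suc (∣p─q∣+∣q∣ p q (drop-∷-⊆ q⊆p))
∣p─q∣+∣q∣ (outside ∷ p) (outside ∷ q) q⊆p = ∣p─q∣+∣q∣ p q (drop-∷-⊆ q⊆p)
∣p─q∣+∣q∣ (inside  ∷ p) (inside  ∷ q) q⊆p =
  trans (+-suc _ _) (cong suc (∣p─q∣+∣q∣ p q (drop-∷-⊆ q⊆p)))
∣p─q∣+∣q∣ (outside ∷ p) (inside  ∷ q) q⊆p with q⊆p here
... | ()

x∈p─q⇒x∉q : ∀ {k} (p q : Subset k) {x} → x ∈ p ─ q → x ∉ q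
x∈p─q⇒x∉q (s ∷ p) (inside ∷ q) () here
x∈p─q⇒x∉q (s ∷ p) (t ∷ q) (there x∈p─q) (there x∈q) = x∈p─q⇒x∉q p q x∈p─q x∈q

∨-true : ∀ {a b} → a ∨ b ≡ true → a ≡ true ⊎ b ≡ true
∨-true {true}  _  = inj₁ refl
∨-true {false} b≡ = inj₂ b≡

anyFin-intro : ∀ {k} (f : Fin k → Bool) j → f j ≡ true → anyFin f ≡ true
anyFin-intro f zero    fj rewrite fj = refl
anyFin-intro f (suc j) fj with f zero
... | true  = refl
... | false = anyFin-intro (λ i → f (suc i)) j fj

anyFin-elim : ∀ {k} (f : Fin k → Bool) → anyFin f ≡ true → Σ[ j ∈ Fin k ] f j ≡ true
anyFin-elim {suc k} f any with f zero in f0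
... | true  = zero , f0
... | false with anyFin-elim (λ i → f (suc i)) any
...   | j , fj = suc j , fj

anyFin-∨ : ∀ {k} (f g : Fin k → Bool) → anyFin (λ j → f j ∨ g j) ≡ anyFin f ∨ anyFin g
anyFin-∨ {zero}  f g = refl
anyFin-∨ {suc k} f g = trans
  (cong ((f zero ∨ g zero) ∨_) (anyFin-∨ (λ i → f (suc i)) (λ i → g (suc i))))
  (interchange (f zero) (g zero) _ _)

anyFin-false : ∀ {k} → anyFin {k} (λ _ → false) ≡ false
anyFin-false {zero}  = refl
anyFin-false {suc k} = anyFin-false {k}

AtMostOne : ∀ {k} → (Fin k → Bool) → Set
AtMostOne r = ∀ j j′ → r j ≡ true → r j′ ≡ true → j ≡ j′

ind-anyFin : ∀ {k} (r : Fin k → Bool) → AtMostOne r → ind (anyFin r) ≡ sumFin (λ j → ind (r j))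
ind-anyFin {zero}  r one = refl
ind-anyFin {suc k} r one with r zero in r0
... | true  = cong suc (sym (trans (sumFin-cong (λ j → cong ind (restFalse j))) (sumFin-zero {k})))
  where
  restFalse : ∀ j → r (suc j) ≡ false
  restFalse j = ¬-not (λ rj → 0≢1+n (one zero (suc j) r0 rj))
... | false = ind-anyFin (λ j → r (suc j)) (λ j j′ rj rj′ → suc-injective (one (suc j) (suc j′) rj rj′))

-- The task half is the worker half of the
-- transpose, so every fact below is proved once and used for both sides.
record WorkerSide {w n : ℕ} (W : Subset w) (A : Assign w n) : Set where
  field
    assignedIn  : ∀ i j → A i j ≡ true → i ∈ W
    oneTaskEach : ∀ i → AtMostOne (A i)

workerSide : ∀ {w n} {W : Subset w} {T : Subset n} {A : Assign w n} →
  IsMatching W T A → WorkerSide W A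
workerSide M = record { assignedIn = inW ; oneTaskEach = uniqueT }
  where open IsMatching M

taskSide : ∀ {w n} {W : Subset w} {T : Subset n} {A : Assign w n} →
  IsMatching W T A → WorkerSide T (transpose A)
taskSide M = record { assignedIn = λ j i → inT i j ; oneTaskEach = λ j i i′ → uniqueW i i′ j }
  where open IsMatching M

fromSides : ∀ {w n} {W : Subset w} {T : Subset n} {A : Assign w n} →
  WorkerSide W A → WorkerSide T (transpose A) → IsMatching W T A
fromSides ws ts = record
  { inW = WorkerSide.assignedIn ws
  ; inT = λ i j → WorkerSide.assignedIn ts j i
  ; uniqueT = WorkerSide.oneTaskEach ws
  ; uniqueW = λ i i′ j → WorkerSide.oneTaskEach ts j i i′
  }

matchedW⊆ : ∀ {w n} {W : Subset w} {A : Assign w n} → WorkerSide W A → matchedW A ⊆ W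
matchedW⊆ {A = A} ws i∈ with anyFin-elim (A _) (∈-tabulate⁻ i∈)
... | j , Aij = WorkerSide.assignedIn ws _ j Aij

∣matchedW∣ : ∀ {w n} {W : Subset w} {A : Assign w n} → WorkerSide W A → ∣ matchedW A ∣ ≡ count A
∣matchedW∣ {A = A} ws = trans (∣tabulate∣ (λ i → anyFin (A i)))
  (sumFin-cong (λ i → ind-anyFin (A i) (WorkerSide.oneTaskEach ws i)))

output-balanced : ∀ {w n} {W : Subset w} {T : Subset n} {A : Assign w n} →
  IsMatching W T A → Balanced W T → Balanced (W ─ matchedW A) (T ─ matchedT A)
output-balanced {W = W} {T} {A} M W≈T = +-cancelʳ-≡ (count A) _ _ (begin
  ∣ W ─ MW ∣ + count A   ≡⟨ cong (∣ W ─ MW ∣ +_) (sym (∣matchedW∣ (workerSide M))) ⟩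
  ∣ W ─ MW ∣ + ∣ MW ∣    ≡⟨ ∣p─q∣+∣q∣ W MW (matchedW⊆ (workerSide M)) ⟩
  ∣ W ∣                  ≡⟨ W≈T ⟩
  ∣ T ∣                  ≡⟨ sym (∣p─q∣+∣q∣ T MT (matchedW⊆ (taskSide M))) ⟩
  ∣ T ─ MT ∣ + ∣ MT ∣    ≡⟨ cong (∣ T ─ MT ∣ +_) (trans (∣matchedW∣ (taskSide M)) (count-transpose A)) ⟩
  ∣ T ─ MT ∣ + count A   ∎)
  where
  open ≡-Reasoning
  MW = matchedW A
  MT = matchedT A

paa-output-balanced : ∀ {w n} {ψ : Alg w n} → IsPAA ψ → ∀ W T → Balanced W T →
  Balanced (proj₁ (output ψ W T)) (proj₂ (output ψ W T))
paa-output-balanced pψ W T W≈T = output-balanced (pψ W T W≈T) W≈T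

union-workerSide : ∀ {w n} {W : Subset w} {A B : Assign w n} →
  WorkerSide W A → WorkerSide (W ─ matchedW A) B → WorkerSide W (A ∪A B)
union-workerSide {W = W} {A} {B} wA wB = record { assignedIn = assignedIn ; oneTaskEach = oneTaskEach }
  where
  module A = WorkerSide wA
  module B = WorkerSide wB

  disjoint : ∀ i j j′ → A i j ≡ true → B i j′ ≢ true
  disjoint i j j′ Aij Bij′ =
    x∈p─q⇒x∉q W (matchedW A) (B.assignedIn i j′ Bij′) (∈-tabulate⁺ (anyFin-intro (A i) j Aij))

  assignedIn : ∀ i j → (A ∪A B) i j ≡ true → i ∈ W
  assignedIn i j e with ∨-true {A i j} e
  ... | inj₁ Aij = A.assignedIn i j Aij
  ... | inj₂ Bij = p─q⊆p W (matchedW A) (B.assignedIn i j Bij)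

  oneTaskEach : ∀ i → AtMostOne ((A ∪A B) i)
  oneTaskEach i j j′ e e′ with ∨-true {A i j} e | ∨-true {A i j′} e′
  ... | inj₁ Aij | inj₁ Aij′ = A.oneTaskEach i j j′ Aij Aij′
  ... | inj₁ Aij | inj₂ Bij′ = contradiction Bij′ (disjoint i j j′ Aij)
  ... | inj₂ Bij | inj₁ Aij′ = contradiction Bij (disjoint i j′ j Aij′)
  ... | inj₂ Bij | inj₂ Bij′ = B.oneTaskEach i j j′ Bij Bij′

then-PAA : ∀ {w n} {ψ φ : Alg w n} → IsPAA ψ → IsPAA φ → IsPAA (ψ then φ)
then-PAA {ψ = ψ} {φ} pψ pφ W T W≈T = fromSides
  (union-workerSide (workerSide Mψ) (workerSide Mφ))
  (union-workerSide (taskSide Mψ) (taskSide Mφ))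
  where
  W′ = W ─ matchedW (ψ W T)
  T′ = T ─ matchedT (ψ W T)
  Mψ : IsMatching W T (ψ W T)
  Mψ = pψ W T W≈T
  Mφ : IsMatching W′ T′ (φ W′ T′)
  Mφ = pφ W′ T′ (output-balanced Mψ W≈T)

─matchedW-∪ : ∀ {w n} (p : Subset w) (A B : Assign w n) →
  p ─ matchedW (A ∪A B) ≡ (p ─ matchedW A) ─ matchedW B
─matchedW-∪ p A B = begin
  p ─ matchedW (A ∪A B)               ≡⟨ cong (p ─_) (tabulate-cong (λ i → anyFin-∨ (A i) (B i))) ⟩
  p ─ tabulate (λ i → anyFin (A i) ∨ anyFin (B i))
                                      ≡⟨ cong (p ─_) (sym (tabulate-∪ _ _)) ⟩
  p ─ (matchedW A ∪ matchedW B)       ≡⟨ sym (p─q─r≡p─q∪r p _ _) ⟩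
  (p ─ matchedW A) ─ matchedW B       ∎
  where open ≡-Reasoning

UnitDistanceOf : ∀ {w n} → Subset w × Subset n → Subset w × Subset n → Set
UnitDistanceOf (W₁ , T₁) (W₂ , T₂) = UnitDistance W₁ T₁ W₂ T₂

output-then : ∀ {w n} (ψ φ : Alg w n) W T →
  output (ψ then φ) W T ≡ output φ (proj₁ (output ψ W T)) (proj₂ (output ψ W T))
output-then ψ φ W T = cong₂ _,_ (─matchedW-∪ W A B) (─matchedW-∪ T (transpose A) (transpose B))
  where
  A = ψ W T
  B = φ (proj₁ (output ψ W T)) (proj₂ (output ψ W T))

then-CF : ∀ {w n} {ψ φ : Alg w n} → IsPAA ψ → CompositionFriendly ψ → CompositionFriendly φ →
  CompositionFriendly (ψ then φ)
then-CF {w} {n} {ψ} {φ} pψ cψ cφ W₁ T₁ W₂ T₂ b₁ b₂ u =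
  subst₂ UnitDistanceOf (sym (output-then ψ φ W₁ T₁)) (sym (output-then ψ φ W₂ T₂))
    (cφ (proj₁ out₁) (proj₂ out₁) (proj₁ out₂) (proj₂ out₂)
        (paa-output-balanced pψ W₁ T₁ b₁) (paa-output-balanced pψ W₂ T₂ b₂)
        (cψ W₁ T₁ W₂ T₂ b₁ b₂ u))
  where
  out₁ out₂ : Subset w × Subset n
  out₁ = output ψ W₁ T₁
  out₂ = output ψ W₂ T₂

-- Switching costs add: ψ's inputs are at unit distance, and so are φ's.
then-SC : ∀ {w n} {ψ φ : Alg w n} {s t : ℕ} → IsPAA ψ → CompositionFriendly ψ →
  SwitchingCostBounded s ψ → SwitchingCostBounded t φ → SwitchingCostBounded (s + t) (ψ then φ)
then-SC {ψ = ψ} pψ cψ sψ sφ W₁ T₁ W₂ T₂ b₁ b₂ u = ≤-trans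
  (union-symDiff (ψ W₁ T₁) _ (ψ W₂ T₂) _)
  (+-mono-≤ (sψ W₁ T₁ W₂ T₂ b₁ b₂ u)
            (sφ _ _ _ _ (paa-output-balanced pψ W₁ T₁ b₁) (paa-output-balanced pψ W₂ T₂ b₂)
                (cψ W₁ T₁ W₂ T₂ b₁ b₂ u)))

idle : ∀ {w n} → Alg w n
idle W T = noAssign

idle-PAA : ∀ {w n} → IsPAA {w} {n} idle
idle-PAA W T _ = record { inW = λ _ _ () ; inT = λ _ _ () ; uniqueT = λ _ _ _ () ; uniqueW = λ _ _ _ () }

matchedW-noAssign : ∀ {w n} → matchedW {w} {n} noAssign ≡ ⊥
matchedW-noAssign {zero}      = refl
matchedW-noAssign {suc w} {n} = cong₂ _∷_ (anyFin-false {n}) (matchedW-noAssign {w} {n})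

output-idle : ∀ {w n} (W : Subset w) (T : Subset n) → output idle W T ≡ (W , T)
output-idle {w} {n} W T = cong₂ _,_
  (trans (cong (W ─_) (matchedW-noAssign {w} {n})) (p─⊥≡p W))
  (trans (cong (T ─_) (matchedW-noAssign {n} {w})) (p─⊥≡p T))

idle-CF : ∀ {w n} → CompositionFriendly {w} {n} idle
idle-CF W₁ T₁ W₂ T₂ _ _ u = subst₂ UnitDistanceOf (sym (output-idle W₁ T₁)) (sym (output-idle W₂ T₂)) u

idle-SC : ∀ {w n} → SwitchingCostBounded {w} {n} 0 idle
idle-SC {w} {n} _ _ _ _ _ _ _ = ≤-reflexive (count-noAssign {w} {n})

lemma13 : {w n m : ℕ} (ψ : Fin m → Alg w n) (s : Fin m → ℕ) →
    (∀ i → IsPAA (ψ i)) →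
    (∀ i → CompositionFriendly (ψ i)) →
    (∀ i → SwitchingCostBounded (s i) (ψ i)) →
    IsPAA (inSequence ψ) × CompositionFriendly (inSequence ψ)
      × SwitchingCostBounded (sumFin s) (inSequence ψ)
lemma13 {m = zero}  ψ s p c sc = idle-PAA , idle-CF , idle-SC
lemma13 {m = suc m} ψ s p c sc
  with lemma13 (λ i → ψ (suc i)) (λ i → s (suc i)) (λ i → p (suc i)) (λ i → c (suc i)) (λ i → sc (suc i))
... | restPAA , restCF , restSC =
    then-PAA (p zero) restPAA
  , then-CF (p zero) (c zero) restCF
  , then-SC {φ = inSequence (λ i → ψ (suc i))} (p zero) (c zero) (sc zero) restSC
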